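{- Let $\mathcal L$ be a summable category, let $n\in\mathbb N$, let $f_1,\dots,f_n\in\mathcal L(X,Y)$ and let $p$ be a permutation of $\{1,\dots,n\}$. Then the family $(f_i)_{i=1}^n$ is summable if and only if the family $(f_{p(i)})_{i=1}^n$ is summable, and in that case $\sum_{i=1}^n f_i=\sum_{i=1}^n f_{p(i)}$.
   Context: Let $\mathcal L$ be a category enriched over pointed sets (each hom-set has a distinguished $0$ with $g\circ 0=0$, $0\circ f=0$). A pre-summability structure is $(S,\pi_0,\pi_1,\sigma)$ with $S:\mathcal L\to\mathcal L$ a functor, $S0=0$, and $\pi_0,\pi_1,\sigma$ natural transformations $S\Rightarrow\mathrm{Id}$ with $\pi_0,\pi_1$ jointly monic. $f_0,f_1\in\mathcal L(X,Y)$ are summable if there is (necessarily unique) $\langle f_0,f_1\rangle_S\in\mathcal L(X,SY)$ with $\pi_i\circ\langle f_0,f_1\rangle_S=f_i$; then $f_0+f_1:=\sigma\circ\langle f_0,f_1\rangle_S$. A summable category is one equipped with such a structure satisfying: (S-com) $\pi_1,\pi_0$ are summable and $\sigma\circ\langle\pi_1,\pi_0\rangle_S=\sigma$; (S-zero) for each $f$, $f$ and $0$ are summable with $f+0=f$; (S-witness) if $(f_{00},f_{01})$, $(f_{10},f_{11})$ are summable and $(f_{00}+f_{01},f_{10}+f_{11})$ is summable then $\langle f_{00},f_{01}\rangle_S,\langle f_{10},f_{11}\rangle_S$ are summable; (S-assoc) $S(\sigma_X)\circ c_X=\sigma_{SX}$ where $c_X$ is the unique endomorphism of $S^2X$ with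 $\pi_{i,X}\pi_{j,SX}c_X=\pi_{j,X}\pi_{i,SX}$ for all $i,j$. Summable families are defined by induction on $n$: the empty family is summable with sum $0$; for $n>0$, $(f_i)_{i=1}^n$ is summable if $(f_i)_{i=1}^{n-1}$ is summable and the pair $(f_1+\cdots+f_{n-1},f_n)$ is summable, and then $\sum_{i=1}^nf_i=(f_1+\cdots+f_{n-1})+f_n$. -}

module Defs where

open import Level using (Level; _⊔_; suc)
open import Data.Nat using (ℕ; zero; suc)
open import Data.Fin using (Fin; inject₁; fromℕ)
open import Data.Product using (Σ; _×_; _,_; proj₁; proj₂)
open import Data.Unit.Polymorphic using (⊤)
open import Relation.Binary.PropositionalEquality using (_≡_)

record PointedCategory (o ℓ : Level) : Set (Level.suc (o ⊔ ℓ)) where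
  infixr 9 _∘_
  field
    Obj  : Set o
    Hom  : Obj → Obj → Set ℓ
    id   : ∀ {X} → Hom X X
    _∘_  : ∀ {X Y Z} → Hom Y Z → Hom X Y → Hom X Z
    identityˡ : ∀ {X Y} (f : Hom X Y) → id ∘ f ≡ f
    identityʳ : ∀ {X Y} (f : Hom X Y) → f ∘ id ≡ f
    assoc : ∀ {W X Y Z} (h : Hom Y Z) (g : Hom X Y) (f : Hom W X) →
            (h ∘ g) ∘ f ≡ h ∘ (g ∘ f)
    0m   : ∀ {X Y} → Hom X Y
    zeroˡ : ∀ {X Y Z} (g : Hom Y Z) → g ∘ 0m {X} ≡ 0m
    zeroʳ : ∀ {X Y Z} (f : Hom X Y) → 0m {Y} {Z} ∘ f ≡ 0m

record PreSummability {o ℓ} (C : PointedCategory o ℓ) : Set (o ⊔ ℓ) where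
  open PointedCategory C
  field
    S₀ : Obj → Obj
    S₁ : ∀ {X Y} → Hom X Y → Hom (S₀ X) (S₀ Y)
    S-id : ∀ {X} → S₁ (id {X}) ≡ id
    S-∘  : ∀ {X Y Z} (g : Hom Y Z) (f : Hom X Y) → S₁ (g ∘ f) ≡ S₁ g ∘ S₁ f
    S-0  : ∀ {X Y} → S₁ (0m {X} {Y}) ≡ 0m
    π₀ π₁ σ : ∀ X → Hom (S₀ X) X
    π₀-nat : ∀ {X Y} (f : Hom X Y) → π₀ Y ∘ S₁ f ≡ f ∘ π₀ X
    π₁-nat : ∀ {X Y} (f : Hom X Y) → π₁ Y ∘ S₁ f ≡ f ∘ π₁ X
    σ-nat  : ∀ {X Y} (f : Hom X Y) → σ Y ∘ S₁ f ≡ f ∘ σ X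
    jointly-monic : ∀ {Z X} (g h : Hom Z (S₀ X)) →
                    π₀ X ∘ g ≡ π₀ X ∘ h → π₁ X ∘ g ≡ π₁ X ∘ h → g ≡ h

  -- f₀, f₁ summable: a witness ⟨f₀,f₁⟩_S (unique by joint monicity)
  Summable : ∀ {X Y} → Hom X Y → Hom X Y → Set ℓ
  Summable {X} {Y} f₀ f₁ = Σ (Hom X (S₀ Y)) λ h → (π₀ Y ∘ h ≡ f₀) × (π₁ Y ∘ h ≡ f₁)

  plus : ∀ {X Y} {f₀ f₁ : Hom X Y} → Summable f₀ f₁ → Hom X Y
  plus {Y = Y} w = σ Y ∘ proj₁ w

  IsExchange : ∀ X → Hom (S₀ (S₀ X)) (S₀ (S₀ X)) → Set ℓ
  IsExchange X c =
      (π₀ X ∘ π₀ (S₀ X) ∘ c ≡ π₀ X ∘ π₀ (S₀ X))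
    × (π₀ X ∘ π₁ (S₀ X) ∘ c ≡ π₁ X ∘ π₀ (S₀ X))
    × (π₁ X ∘ π₀ (S₀ X) ∘ c ≡ π₀ X ∘ π₁ (S₀ X))
    × (π₁ X ∘ π₁ (S₀ X) ∘ c ≡ π₁ X ∘ π₁ (S₀ X))

record SummableCategory (o ℓ : Level) : Set (Level.suc (o ⊔ ℓ)) where
  field
    cat : PointedCategory o ℓ
    pre : PreSummability cat
  open PointedCategory cat public
  open PreSummability pre public
  field
    S-com : ∀ X → Σ (Summable (π₁ X) (π₀ X)) λ w → σ X ∘ proj₁ w ≡ σ X
    S-zero : ∀ {X Y} (f : Hom X Y) → Σ (Summable f 0m) λ w → plus w ≡ f
    S-witness : ∀ {X Y} {f₀₀ f₀₁ f₁₀ f₁₁ : Hom X Y}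
      (w₀ : Summable f₀₀ f₀₁) (w₁ : Summable f₁₀ f₁₁) →
      Summable (plus w₀) (plus w₁) → Summable (proj₁ w₀) (proj₁ w₁)
    S-assoc : ∀ X (c : Hom (S₀ (S₀ X)) (S₀ (S₀ X))) → IsExchange X c →
      S₁ (σ X) ∘ c ≡ σ (S₀ X)

module _ {o ℓ} (𝓛 : SummableCategory o ℓ) where
  open SummableCategory 𝓛

  -- Summable families indexed by Fin n (index i ↔ f_{i+1}), defined
  -- mutually with their sum, by induction on n as in the paper.
  SummableFam : ∀ {X Y} (n : ℕ) → (Fin n → Hom X Y) → Set ℓ
  sumFam : ∀ {X Y} (n : ℕ) (f : Fin n → Hom X Y) → SummableFam n f → Hom X Y

  SummableFam zero f = ⊤
  SummableFam (suc n) f =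
    Σ (SummableFam n (λ i → f (inject₁ i))) λ s →
      Summable (sumFam n (λ i → f (inject₁ i)) s) (f (fromℕ n))

  sumFam zero f _ = 0m
  sumFam (suc n) f (s , w) = plus w

{-# OPTIONS --safe #-}
module Submission where

-- The interchange law (a + b) + (c + d) = (a + c) + (b + d), with all the
-- sums on the right defined, follows from S-witness, which provides a
-- common witness H : X → S²Y for the four summands, and S-assoc, which
-- lets the exchange map c transpose H. Taking d = 0 gives
-- (a + b) + c = (a + c) + b, so any summand of a summable family can be
-- moved to the last position. A permutation p of a family of length n + 1
-- is then handled by moving the summand p(n) to the end and applying
-- induction to the remaining n summands.

open import Defs
open import Data.Nat using (ℕ; zero; suc)
open import Data.Fin using (Fin; zero; suc; inject₁; fromℕ; punchIn)
open import Data.Fin.Relation.Unary.Top using (View; ‵fromℕ; ‵inj₁; view)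
open import Data.Fin.Permutation
  using (Permutation′; _⟨$⟩ʳ_; remove; flip; inverseʳ; punchIn-permute)
open import Data.Product using (Σ; _×_; _,_; proj₁; proj₂)
open import Function.Bundles using (_⇔_; mk⇔)
open import Relation.Binary.PropositionalEquality
  using (_≡_; refl; sym; trans; cong; module ≡-Reasoning)

open ≡-Reasoning

punchIn-fromℕ : ∀ {n} (j : Fin n) → punchIn (fromℕ n) j ≡ inject₁ j
punchIn-fromℕ zero    = refl
punchIn-fromℕ (suc j) = cong suc (punchIn-fromℕ j)

inject₁-punchIn : ∀ {n} (k : Fin (suc n)) (j : Fin n) →
                  inject₁ (punchIn k j) ≡ punchIn (inject₁ k) (inject₁ j)
inject₁-punchIn zero    j       = refl
inject₁-punchIn (suc k) zero    = refl
inject₁-punchIn (suc k) (suc j) = cong suc (inject₁-punchIn k j)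

punchIn-inject₁-fromℕ : ∀ {n} (k : Fin (suc n)) →
                        punchIn (inject₁ k) (fromℕ n) ≡ fromℕ (suc n)
punchIn-inject₁-fromℕ zero            = refl
punchIn-inject₁-fromℕ {suc n} (suc k) = cong suc (punchIn-inject₁-fromℕ k)

permute-inject₁ : ∀ {n} (p : Permutation′ (suc n)) (j : Fin n) →
  p ⟨$⟩ʳ inject₁ j ≡ punchIn (p ⟨$⟩ʳ fromℕ n) (remove (fromℕ n) p ⟨$⟩ʳ j)
permute-inject₁ {n} p j = begin
  p ⟨$⟩ʳ inject₁ j                                    ≡⟨ cong (p ⟨$⟩ʳ_) (sym (punchIn-fromℕ j)) ⟩
  p ⟨$⟩ʳ punchIn (fromℕ n) j                          ≡⟨ punchIn-permute p (fromℕ n) j ⟩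
  punchIn (p ⟨$⟩ʳ fromℕ n) (remove (fromℕ n) p ⟨$⟩ʳ j)  ∎

module SummableCategoryProperties {o ℓ} (𝓛 : SummableCategory o ℓ) where
  open SummableCategory 𝓛

  pullˡ : ∀ {W X Y Z} {a : Hom Y Z} {b : Hom X Y} {c : Hom X Z} (f : Hom W X) →
          a ∘ b ≡ c → a ∘ b ∘ f ≡ c ∘ f
  pullˡ {a = a} {b} f e = trans (sym (assoc a b f)) (cong (_∘ f) e)

  Summable-resp : ∀ {X Y} {a b a′ b′ : Hom X Y} →
                  Summable a b → a ≡ a′ → b ≡ b′ → Summable a′ b′
  Summable-resp (h , h₀ , h₁) e e′ = h , trans h₀ e , trans h₁ e′

  plus-cong : ∀ {X Y} {a b a′ b′ : Hom X Y} (w : Summable a b) (w′ : Summable a′ b′) →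
              a ≡ a′ → b ≡ b′ → plus w ≡ plus w′
  plus-cong {Y = Y} (h , h₀ , h₁) (h′ , h′₀ , h′₁) e e′ =
    cong (σ Y ∘_) (jointly-monic h h′ (trans h₀ (trans e (sym h′₀)))
                                       (trans h₁ (trans e′ (sym h′₁))))

  exchange : ∀ Y → Σ (Hom (S₀ (S₀ Y)) (S₀ (S₀ Y))) (IsExchange Y)
  exchange Y = transpose (S-witness row₀ row₁ columns)
    where
    row₀ : Summable (π₀ Y ∘ π₀ (S₀ Y)) (π₀ Y ∘ π₁ (S₀ Y))
    row₀ = S₁ (π₀ Y) , π₀-nat (π₀ Y) , π₁-nat (π₀ Y)

    row₁ : Summable (π₁ Y ∘ π₀ (S₀ Y)) (π₁ Y ∘ π₁ (S₀ Y))
    row₁ = S₁ (π₁ Y) , π₀-nat (π₁ Y) , π₁-nat (π₁ Y)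

    columns : Summable (plus row₀) (plus row₁)
    columns = σ (S₀ Y) , sym (σ-nat (π₀ Y)) , sym (σ-nat (π₁ Y))

    transpose : Summable (S₁ (π₀ Y)) (S₁ (π₁ Y)) → Σ (Hom (S₀ (S₀ Y)) (S₀ (S₀ Y))) (IsExchange Y)
    transpose (c , c₀ , c₁) =
      c , trans (cong (π₀ Y ∘_) c₀) (π₀-nat (π₀ Y)) , trans (cong (π₀ Y ∘_) c₁) (π₀-nat (π₁ Y))
        , trans (cong (π₁ Y ∘_) c₀) (π₁-nat (π₀ Y)) , trans (cong (π₁ Y ∘_) c₁) (π₁-nat (π₁ Y))

  interchange : ∀ {X Y} {f₀₀ f₀₁ f₁₀ f₁₁ : Hom X Y}
    (w₀ : Summable f₀₀ f₀₁) (w₁ : Summable f₁₀ f₁₁) (W : Summable (plus w₀) (plus w₁)) →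
    Σ (Summable f₀₀ f₁₀) λ v₀ → Σ (Summable f₀₁ f₁₁) λ v₁ →
      Σ (Summable (plus v₀) (plus v₁)) λ V → plus V ≡ plus W
  interchange {X} {Y} {f₀₀} {f₀₁} {f₁₀} {f₁₁}
              w₀@(h₀ , h₀₀ , h₀₁) w₁@(h₁ , h₁₀ , h₁₁) W@(hW , hW₀ , hW₁) =
    transpose (S-witness w₀ w₁ W) (exchange Y)
    where
    entry : ∀ {H : Hom X (S₀ (S₀ Y))} {c} {a a′ : Hom (S₀ Y) Y} {b b′ : Hom (S₀ (S₀ Y)) (S₀ Y)}
              {h : Hom X (S₀ Y)} {f : Hom X Y} →
            a ∘ b ∘ c ≡ a′ ∘ b′ → b′ ∘ H ≡ h → a′ ∘ h ≡ f → a ∘ b ∘ c ∘ H ≡ f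
    entry {H} {c} {a} {a′} {b} {b′} {h} {f} abc b′H a′h = begin
      a ∘ b ∘ c ∘ H    ≡⟨ cong (a ∘_) (sym (assoc b c H)) ⟩
      a ∘ (b ∘ c) ∘ H  ≡⟨ pullˡ H abc ⟩
      (a′ ∘ b′) ∘ H    ≡⟨ assoc a′ b′ H ⟩
      a′ ∘ b′ ∘ H      ≡⟨ cong (a′ ∘_) b′H ⟩
      a′ ∘ h           ≡⟨ a′h ⟩
      f                ∎

    through-σ : ∀ {π : Hom (S₀ Y) Y} {πS : Hom (S₀ (S₀ Y)) (S₀ Y)} (L : Hom X (S₀ (S₀ Y))) →
                π ∘ S₁ (σ Y) ≡ σ Y ∘ πS → π ∘ S₁ (σ Y) ∘ L ≡ σ Y ∘ πS ∘ L
    through-σ {πS = πS} L nat = trans (pullˡ L nat) (assoc (σ Y) πS L)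

    transpose : Summable h₀ h₁ → Σ (Hom (S₀ (S₀ Y)) (S₀ (S₀ Y))) (IsExchange Y) →
      Σ (Summable f₀₀ f₁₀) λ v₀ → Σ (Summable f₀₁ f₁₁) λ v₁ →
        Σ (Summable (plus v₀) (plus v₁)) λ V → plus V ≡ plus W
    transpose (H , H₀ , H₁) (c , c₀₀ , c₀₁ , c₁₀ , c₁₁) =
        (π₀ (S₀ Y) ∘ c ∘ H , entry c₀₀ H₀ h₀₀ , entry c₁₀ H₁ h₁₀)
      , (π₁ (S₀ Y) ∘ c ∘ H , entry c₀₁ H₀ h₀₁ , entry c₁₁ H₁ h₁₁)
      , (S₁ (σ Y) ∘ c ∘ H , through-σ (c ∘ H) (π₀-nat (σ Y)) , through-σ (c ∘ H) (π₁-nat (σ Y)))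
      , sum-transposed
      where
      S₁σ∘H≡hW : S₁ (σ Y) ∘ H ≡ hW
      S₁σ∘H≡hW = jointly-monic _ _
        (trans (through-σ H (π₀-nat (σ Y))) (trans (cong (σ Y ∘_) H₀) (sym hW₀)))
        (trans (through-σ H (π₁-nat (σ Y))) (trans (cong (σ Y ∘_) H₁) (sym hW₁)))

      sum-transposed : σ Y ∘ S₁ (σ Y) ∘ c ∘ H ≡ σ Y ∘ hW
      sum-transposed = begin
        σ Y ∘ S₁ (σ Y) ∘ c ∘ H  ≡⟨ cong (σ Y ∘_) (pullˡ H (S-assoc Y c (c₀₀ , c₀₁ , c₁₀ , c₁₁))) ⟩
        σ Y ∘ σ (S₀ Y) ∘ H      ≡⟨ sym (assoc (σ Y) (σ (S₀ Y)) H) ⟩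
        (σ Y ∘ σ (S₀ Y)) ∘ H    ≡⟨ sym (pullˡ H (σ-nat (σ Y))) ⟩
        σ Y ∘ S₁ (σ Y) ∘ H      ≡⟨ cong (σ Y ∘_) S₁σ∘H≡hW ⟩
        σ Y ∘ hW                ∎

  plus-swapʳ : ∀ {X Y} {a b c : Hom X Y} (w : Summable a b) (W : Summable (plus w) c) →
    Σ (Summable a c) λ v → Σ (Summable (plus v) b) λ V → plus V ≡ plus W
  plus-swapʳ {b = b} {c} w W with S-zero c
  ... | c+0 , c+0≡c with interchange w c+0 (Summable-resp W refl (sym c+0≡c))
  ...   | v , b+0 , V , e = v , Summable-resp V refl b+0≡b , e
    where
    b+0≡b : plus b+0 ≡ b
    b+0≡b = trans (plus-cong b+0 (proj₁ (S-zero b)) refl refl) (proj₂ (S-zero b))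

  sumFam-cong : ∀ {X Y} n {f g : Fin n → Hom X Y} → (∀ i → f i ≡ g i) →
    (s : SummableFam 𝓛 n f) (t : SummableFam 𝓛 n g) → sumFam 𝓛 n f s ≡ sumFam 𝓛 n g t
  sumFam-cong zero    f≗g s       t       = refl
  sumFam-cong (suc n) f≗g (s , w) (t , v) =
    plus-cong w v (sumFam-cong n (λ i → f≗g (inject₁ i)) s t) (f≗g (fromℕ n))

  SummableFam-resp : ∀ {X Y} n {f g : Fin n → Hom X Y} → (∀ i → f i ≡ g i) →
    SummableFam 𝓛 n f → SummableFam 𝓛 n g
  SummableFam-resp zero    f≗g s       = _
  SummableFam-resp (suc n) f≗g (s , w) =
    let t = SummableFam-resp n (λ i → f≗g (inject₁ i)) s in
    t , Summable-resp w (sumFam-cong n (λ i → f≗g (inject₁ i)) s t) (f≗g (fromℕ n))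

  move-to-last : ∀ {X Y} n (f : Fin (suc n) → Hom X Y) {k : Fin (suc n)} → View k →
    (s : SummableFam 𝓛 (suc n) f) →
    Σ (SummableFam 𝓛 n (λ j → f (punchIn k j))) λ s′ →
      Σ (Summable (sumFam 𝓛 n (λ j → f (punchIn k j)) s′) (f k)) λ w →
        sumFam 𝓛 (suc n) f s ≡ plus w
  move-to-last n f ‵fromℕ (s , w) =
    s′ , Summable-resp w (sumFam-cong n f≗ s s′) refl , refl
    where
    f≗ : ∀ j → f (inject₁ j) ≡ f (punchIn (fromℕ n) j)
    f≗ j = cong f (sym (punchIn-fromℕ j))
    s′ : SummableFam 𝓛 n (λ j → f (punchIn (fromℕ n) j))
    s′ = SummableFam-resp n f≗ s
  move-to-last (suc n) f (‵inj₁ {i = k} v) (s , W)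
    with move-to-last n (λ i → f (inject₁ i)) v s
  ... | s′ , w , e with plus-swapʳ w (Summable-resp W e refl)
  ...   | u , V , eV = (t , Summable-resp u (sumFam-cong n f≗ s′ t) last≡) , V , sym eV
    where
    f≗ : ∀ j → f (inject₁ (punchIn k j)) ≡ f (punchIn (inject₁ k) (inject₁ j))
    f≗ j = cong f (inject₁-punchIn k j)
    t : SummableFam 𝓛 n (λ j → f (punchIn (inject₁ k) (inject₁ j)))
    t = SummableFam-resp n f≗ s′
    last≡ : f (fromℕ (suc n)) ≡ f (punchIn (inject₁ k) (fromℕ n))
    last≡ = cong f (sym (punchIn-inject₁-fromℕ k))

  permute : ∀ {X Y} n (f g : Fin n → Hom X Y) (p : Permutation′ n) → (∀ i → g i ≡ f (p ⟨$⟩ʳ i)) →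
    (s : SummableFam 𝓛 n f) → Σ (SummableFam 𝓛 n g) λ t → sumFam 𝓛 n f s ≡ sumFam 𝓛 n g t
  permute zero    f g p g≗fp s = _ , refl
  permute (suc n) f g p g≗fp s with move-to-last n f (view (p ⟨$⟩ʳ fromℕ n)) s
  ... | s′ , w , e
    with permute n _ (λ j → g (inject₁ j)) (remove (fromℕ n) p)
                 (λ j → trans (g≗fp (inject₁ j)) (cong f (permute-inject₁ p j))) s′
  ...   | t , e′ = (t , Summable-resp w e′ (sym (g≗fp (fromℕ n)))) , e

mainTheorem2 : ∀ {o ℓ} (𝓛 : SummableCategory o ℓ) {X Y : SummableCategory.Obj 𝓛}
    (n : ℕ) (f : Fin n → SummableCategory.Hom 𝓛 X Y) (p : Permutation′ n) →
    (SummableFam 𝓛 n f ⇔ SummableFam 𝓛 n (λ i → f (p ⟨$⟩ʳ i)))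
    × ((s : SummableFam 𝓛 n f) (t : SummableFam 𝓛 n (λ i → f (p ⟨$⟩ʳ i))) →
       sumFam 𝓛 n f s ≡ sumFam 𝓛 n (λ i → f (p ⟨$⟩ʳ i)) t)
mainTheorem2 𝓛 {X} {Y} n f p =
    mk⇔ (λ s → proj₁ (permute n f fp p (λ _ → refl) s))
        (λ t → proj₁ (permute n fp f (flip p) (λ i → cong f (sym (inverseʳ p))) t))
  , λ s t → trans (proj₂ (permute n f fp p (λ _ → refl) s))
                  (sumFam-cong n (λ _ → refl) _ t)
  where
  open SummableCategoryProperties 𝓛
  fp : Fin n → SummableCategory.Hom 𝓛 X Y
  fp i = f (p ⟨$⟩ʳ i)
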